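{- Let $\Phi\subseteq\{I,O,Q,U,\mathit{Self}\}$ and let $\mathcal{I}$ be a traditional interpretation without unreachable objects (w.r.t. $\mathcal{L}_\Phi$). Then: (1) if $\mathcal{I}/^{QS}_{\sim_{\Phi,\mathcal{I}}}$ is finite, it is a minimal QS-interpretation among the QS-interpretations that validate the same terminological axioms in $\mathcal{L}_\Phi$ as $\mathcal{I}$; (2) if $\mathcal{I}/^{QS}_{\sim_{\Phi,\mathcal{I}}}$ is finitely branching, it is a minimal QS-interpretation among the QS-interpretations that satisfy the same concept assertions in $\mathcal{L}_\Phi$ as $\mathcal{I}$.
   Context: Fix finite sets $\Sigma_C,\Sigma_R,\Sigma_I$ of concept, role and individual names. Roles/concepts of $\mathcal{L}_\Phi$: $r\in\Sigma_R$ roles, $A\in\Sigma_C$ concepts; closed under role constructors $\varepsilon, R\circ S, R\sqcup S, R^*, C?$ and concept constructors $\top,\bot,\neg C,C\sqcap D,C\sqcup D,\forall R.C,\exists R.C$; plus $R^-$ if $I\in\Phi$; $\{a\}$ if $O\in\Phi$; $\geq n\,r.C$, $\leq n\,r.C$ if $Q\in\Phi$, and $\geq n\,r^-.C$, $\leq n\,r^-.C$ if $Q,I\in\Phi$; role $U$ if $U\in\Phi$; $\exists r.\mathit{Self}$ if $\mathit{Self}\in\Phi$. A traditional interpretation is extended in the standard way: composition, union, reflexive-transitive closure, $(C?)^{\mathcal{I}}=\{(x,x):x\in C^{\mathcal{I}}\}$, $\varepsilon^{\mathcal{I}}$ identity, $U^{\mathcal{I}}=(\Delta^{\mathcal{I}})^2$,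 inverse, Booleans, $\{a\}^{\mathcal{I}}=\{a^{\mathcal{I}}\}$, $(\exists r.\mathit{Self})^{\mathcal{I}}=\{x:(x,x)\in r^{\mathcal{I}}\}$, $\forall,\exists$, $(\geq n\,R.C)^{\mathcal{I}}=\{x:\#\{y:(x,y)\in R^{\mathcal{I}},y\in C^{\mathcal{I}}\}\ge n\}$, similarly $\le n$. Basic roles: $\Sigma_R\cup\{r^-:r\in\Sigma_R\}$ if $I\in\Phi$, else $\Sigma_R$. An interpretation has no unreachable objects if every element is reachable from some $a^{\mathcal{I}}$ ($a\in\Sigma_I$) by a finite path of edges in $R^{\mathcal{I}}$, $R$ basic; it is finitely branching if $\{y:(x,y)\in R^{\mathcal{I}}\}$ is finite for all $x$ and basic $R$; it is finite if its domain is finite. A QS-interpretation is $\mathcal{J}=(\Delta^{\mathcal{J}},\cdot^{\mathcal{J}},QU^{\mathcal{J}},SE^{\mathcal{J}})$ with $(\Delta^{\mathcal{J}},\cdot^{\mathcal{J}})$ a traditional interpretation, $QU^{\mathcal{J}}$ mapping each basic role $R$ to a function $\Delta^{\mathcal{J}}\times\Delta^{\mathcal{J}}\to\mathbb{N}$ with $QU^{\mathcal{J}}(R)(x,y)>0$ iff $(x,y)\in R^{\mathcal{J}}$, and $SE^{\mathcal{J}}$ mapping each role name to a subset of $\Delta^{\mathcal{J}}$; its semantics is the traditional one except $(\exists r.\mathit{Self})^{\mathcal{J}}=SE^{\mathcal{J}}(r)$ and $(\geq n\,R.C)^{\mathcal{J}}=\{x:\sum_{y\in C^{\mathcal{J}}}QU^{\mathcal{J}}(R)(x,y)\ge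 n\}$, $(\leq n\,R.C)^{\mathcal{J}}=\{x:\sum_{y\in C^{\mathcal{J}}}QU^{\mathcal{J}}(R)(x,y)\le n\}$. Terminological axiom $C\sqsubseteq D$ valid iff $C^{\mathcal{J}}\subseteq D^{\mathcal{J}}$; concept assertion $C(a)$ satisfied iff $a^{\mathcal{J}}\in C^{\mathcal{J}}$. A QS-interpretation is minimal among a class if it belongs to it and its domain has cardinality $\le$ that of every member. $\mathcal{L}_\Phi$-bisimulation $Z\subseteq\Delta^{\mathcal{I}}\times\Delta^{\mathcal{I}'}$ between traditional interpretations: (B1) $Z(a^{\mathcal{I}},a^{\mathcal{I}'})$ for all $a$; (B2) $Z(x,x')\Rightarrow(x\in A^{\mathcal{I}}\iff x'\in A^{\mathcal{I}'})$; (B3) $Z(x,x')\wedge(x,y)\in r^{\mathcal{I}}\Rightarrow\exists y'(Z(y,y')\wedge(x',y')\in r^{\mathcal{I}'})$; (B4) the converse back condition; if $I\in\Phi$: (B5),(B6) analogous for predecessors; if $O\in\Phi$: (B7) $Z(x,x')\Rightarrow(x=a^{\mathcal{I}}\iff x'=a^{\mathcal{I}'})$; if $Q\in\Phi$: (B8) $Z(x,x')$ implies for every $r$ a bijection between $r$-successors of $x$ and of $x'$ contained in $Z$; if $Q,I\in\Phi$ also (B9) the same for $r$-predecessors; if $U\in\Phi$: (B10),(B11) $Z$ total and surjective; if $\mathit{Self}\in\Phi$: (B12) $Z(x,x')\Rightarrow((x,x)\in r^{\mathcal{I}}\iff(x',x')\in r^{\mathcal{I}'})$. $\sim_{\Phi,\mathcal{I}}$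 is the largest $\mathcal{L}_\Phi$-bisimulation between $\mathcal{I}$ and itself (an equivalence), $[x]$ the class of $x$. The quotient QS-interpretation $\mathcal{J}=\mathcal{I}/^{QS}_{\sim_{\Phi,\mathcal{I}}}$: domain $\{[x]\}$, $a^{\mathcal{J}}=[a^{\mathcal{I}}]$, $A^{\mathcal{J}}=\{[x]:x\in A^{\mathcal{I}}\}$, $r^{\mathcal{J}}=\{([x],[y]):(x,y)\in r^{\mathcal{I}}\}$, $QU^{\mathcal{J}}(R)([x],[y])=\max_{x'\in[x]}\#\{y'\in[y]:(x',y')\in R^{\mathcal{I}}\}$, $SE^{\mathcal{J}}(r)=\{[x]:(x,x)\in r^{\mathcal{I}}\}$. -}

module Defs where

open import Level using (Level; _⊔_) renaming (suc to lsuc; zero to lzero)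
open import Data.Nat using (ℕ; _≤_; _<_)
open import Data.Fin using (Fin)
open import Data.Bool using (Bool; T)
open import Data.Unit.Polymorphic using (⊤)
open import Data.Empty.Polymorphic using (⊥)
open import Data.Sum using () renaming (_⊎_ to _⊎'_)
open import Data.Product using (Σ; _×_; _,_; proj₁)
open import Data.List using (List; length; map)
open import Data.Nat.ListAction using (sum)
open import Data.List.Membership.Propositional using (_∈_)
open import Data.List.Relation.Unary.All using (All)
open import Data.List.Relation.Unary.Unique.Propositional using (Unique)
open import Relation.Nullary using (¬_; Irrelevant)
open import Relation.Binary.PropositionalEquality using (_≡_)
open import Relation.Binary.Construct.Closure.ReflexiveTransitive using (Star)
open import Function.Bundles using (_⇔_; _⤖_)
open import Function.Definitions using (Injective)

record Sig : Set where
  field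
    nC nR nI : ℕ

module _ (S : Sig) where
  open Sig S
  CName = Fin nC
  RName = Fin nR
  IName = Fin nI

-- Φ ⊆ {I, O, Q, U, Self}, as a record of flags

record Feats : Set where
  field
    fI fO fQ fU fSelf : Bool

module _ (S : Sig) (Φ : Feats) where
  open Feats Φ

  mutual
    data Role : Set where
      rn    : RName S → Role
      ε     : Role
      _∘ᵣ_  : Role → Role → Role
      _⊔ᵣ_  : Role → Role → Role
      _*ᵣ   : Role → Role
      _?ᵣ   : Concept → Role
      inv   : T fI → Role → Role
      univ  : T fU → Role

    data Concept : Set where
      cn     : CName S → Concept
      top    : Concept
      bot    : Concept
      neg    : Concept → Concept
      _⊓c_   : Concept → Concept → Concept
      _⊔c_   : Concept → Concept → Concept
      all    : Role → Concept → Concept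
      ex     : Role → Concept → Concept
      nom    : T fO → IName S → Concept
      geq    : T fQ → ℕ → RName S → Concept → Concept
      leq    : T fQ → ℕ → RName S → Concept → Concept
      geqInv : T fQ → T fI → ℕ → RName S → Concept → Concept
      leqInv : T fQ → T fI → ℕ → RName S → Concept → Concept
      self   : T fSelf → RName S → Concept

  data Basic : Set where
    bn : RName S → Basic
    bi : T fI → RName S → Basic

record Interp (S : Sig) (ℓ : Level) : Set (lsuc ℓ) where
  field
    Δ        : Set ℓ
    ind      : IName S → Δ
    con      : CName S → Δ → Set ℓ
    rol      : RName S → Δ → Δ → Set ℓ
    con-prop : ∀ A x → Irrelevant (con A x)
    rol-prop : ∀ r x y → Irrelevant (rol r x y)

module _ {S : Sig} {Φ : Feats} {ℓ : Level} (I : Interp S ℓ) where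
  open Interp I

  basicRel : Basic S Φ → Δ → Δ → Set ℓ
  basicRel (bn r)   x y = rol r x y
  basicRel (bi _ r) x y = rol r y x

  module Sem (geqS leqS : ℕ → Basic S Φ → (Δ → Set ℓ) → Δ → Set ℓ)
             (selfS : RName S → Δ → Set ℓ) where
    mutual
      ⟦_⟧R : Role S Φ → Δ → Δ → Set ℓ
      ⟦ rn r ⟧R x y = rol r x y
      ⟦ ε ⟧R x y = x ≡ y
      ⟦ R ∘ᵣ R' ⟧R x z = Σ Δ λ y → ⟦ R ⟧R x y × ⟦ R' ⟧R y z
      ⟦ R ⊔ᵣ R' ⟧R x y = ⟦ R ⟧R x y ⊎' ⟦ R' ⟧R x y
      ⟦ R *ᵣ ⟧R x y = Star ⟦ R ⟧R x y
      ⟦ C ?ᵣ ⟧R x y = x ≡ y × ⟦ C ⟧C x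
      ⟦ inv _ R ⟧R x y = ⟦ R ⟧R y x
      ⟦ univ _ ⟧R x y = ⊤

      ⟦_⟧C : Concept S Φ → Δ → Set ℓ
      ⟦ cn A ⟧C x = con A x
      ⟦ top ⟧C x = ⊤
      ⟦ bot ⟧C x = ⊥
      ⟦ neg C ⟧C x = ¬ ⟦ C ⟧C x
      ⟦ C ⊓c D ⟧C x = ⟦ C ⟧C x × ⟦ D ⟧C x
      ⟦ C ⊔c D ⟧C x = ⟦ C ⟧C x ⊎' ⟦ D ⟧C x
      ⟦ all R C ⟧C x = ∀ y → ⟦ R ⟧R x y → ⟦ C ⟧C y
      ⟦ ex R C ⟧C x = Σ Δ λ y → ⟦ R ⟧R x y × ⟦ C ⟧C y
      ⟦ nom _ a ⟧C x = x ≡ ind a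
      ⟦ geq _ n r C ⟧C x = geqS n (bn r) ⟦ C ⟧C x
      ⟦ leq _ n r C ⟧C x = leqS n (bn r) ⟦ C ⟧C x
      ⟦ geqInv _ i n r C ⟧C x = geqS n (bi i r) ⟦ C ⟧C x
      ⟦ leqInv _ i n r C ⟧C x = leqS n (bi i r) ⟦ C ⟧C x
      ⟦ self _ r ⟧C x = selfS r x

  -- traditional semantics of counting: #{y : (x,y) ∈ R, y ∈ C} ≥ n / ≤ n,
  -- where a set has at least n elements iff it contains n distinct ones
  geqT leqT : ℕ → Basic S Φ → (Δ → Set ℓ) → Δ → Set ℓ
  geqT n R P x = Σ (List Δ) λ ys →
    Unique ys × All (λ y → basicRel R x y × P y) ys × n ≤ length ys
  leqT n R P x = ∀ ys → Unique ys → All (λ y → basicRel R x y × P y) ys →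
    length ys ≤ n

  selfT : RName S → Δ → Set ℓ
  selfT r x = rol r x x

  open Sem geqT leqT selfT public
    renaming (⟦_⟧R to ⟦_⟧ᵀR; ⟦_⟧C to ⟦_⟧ᵀ)

record QSInterp (S : Sig) (Φ : Feats) (ℓ : Level) : Set (lsuc ℓ) where
  field
    base : Interp S ℓ
  open Interp base
  field
    QU     : Basic S Φ → Δ → Δ → ℕ
    QU-pos : ∀ R x y → (0 < QU R x y) ⇔ basicRel {Φ = Φ} base R x y
    SE     : RName S → Δ → Set ℓ
    SE-prop : ∀ r x → Irrelevant (SE r x)
  open Interp base public

module _ {S : Sig} {Φ : Feats} {ℓ : Level} (J : QSInterp S Φ ℓ) where
  open QSInterp J

  -- Σ_{y ∈ C} QU(R)(x,y) ≥ n  /  ≤ n   (sums of naturals over arbitrary sets: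
  -- ≥ n iff some finite subset already sums to ≥ n; ≤ n iff every finite one does)
  geqQ leqQ : ℕ → Basic S Φ → (Δ → Set ℓ) → Δ → Set ℓ
  geqQ n R P x = Σ (List Δ) λ ys →
    Unique ys × All P ys × n ≤ sum (map (QU R x) ys)
  leqQ n R P x = ∀ ys → Unique ys → All P ys → sum (map (QU R x) ys) ≤ n

  open Sem {Φ = Φ} base geqQ leqQ SE public
    renaming (⟦_⟧R to ⟦_⟧ᵠR; ⟦_⟧C to ⟦_⟧ᵠ)

module _ {S : Sig} {Φ : Feats} where

  ValidT : ∀ {ℓ} → Interp S ℓ → Concept S Φ → Concept S Φ → Set ℓ
  ValidT I C D = ∀ x → ⟦_⟧ᵀ I C x → ⟦_⟧ᵀ I D x

  ValidQ : ∀ {ℓ} → QSInterp S Φ ℓ → Concept S Φ → Concept S Φ → Set ℓ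
  ValidQ J C D = ∀ x → ⟦_⟧ᵠ J C x → ⟦_⟧ᵠ J D x

  SatT : ∀ {ℓ} → Interp S ℓ → Concept S Φ → IName S → Set ℓ
  SatT I C a = ⟦_⟧ᵀ I C (Interp.ind I a)

  SatQ : ∀ {ℓ} → QSInterp S Φ ℓ → Concept S Φ → IName S → Set ℓ
  SatQ J C a = ⟦_⟧ᵠ J C (QSInterp.ind J a)

  SameTBox : ∀ {ℓ ℓ'} → Interp S ℓ → QSInterp S Φ ℓ' → Set (ℓ ⊔ ℓ')
  SameTBox I J = ∀ C D → ValidT I C D ⇔ ValidQ J C D

  SameABox : ∀ {ℓ ℓ'} → Interp S ℓ → QSInterp S Φ ℓ' → Set (ℓ ⊔ ℓ')
  SameABox I J = ∀ C a → SatT I C a ⇔ SatQ J C a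

  -- J is minimal among the class: it belongs to the class, and its domain
  -- has cardinality ≤ that of every member K (of universe level ℓK)
  MinimalAmong : ∀ {ℓJ} (a ℓK : Level) →
    (∀ {ℓ} → QSInterp S Φ ℓ → Set (a ⊔ ℓ)) → QSInterp S Φ ℓJ → Set _
  MinimalAmong a ℓK Cls J =
    Cls J × ((K : QSInterp S Φ ℓK) → Cls K →
      Σ (QSInterp.Δ J → QSInterp.Δ K) λ f → Injective _≡_ _≡_ f)

module _ {S : Sig} (Φ : Feats) where
  open Feats Φ

  record IsBisim {ℓ ℓ' z} (I : Interp S ℓ) (I' : Interp S ℓ')
         (Z : Interp.Δ I → Interp.Δ I' → Set z) : Set (ℓ ⊔ ℓ' ⊔ z) where
    private
      module A = Interp I
      module B = Interp I'
    Succ : A.Δ → RName S → Set ℓ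
    Succ x r = Σ A.Δ λ y → A.rol r x y
    Succ' : B.Δ → RName S → Set ℓ'
    Succ' x' r = Σ B.Δ λ y' → B.rol r x' y'
    Pred : A.Δ → RName S → Set ℓ
    Pred x r = Σ A.Δ λ y → A.rol r y x
    Pred' : B.Δ → RName S → Set ℓ'
    Pred' x' r = Σ B.Δ λ y' → B.rol r y' x'
    field
      B1  : ∀ a → Z (A.ind a) (B.ind a)
      B2  : ∀ {x x'} → Z x x' → ∀ A → A.con A x ⇔ B.con A x'
      B3  : ∀ {x x' y} r → Z x x' → A.rol r x y →
              Σ B.Δ λ y' → Z y y' × B.rol r x' y'
      B4  : ∀ {x x' y'} r → Z x x' → B.rol r x' y' →
              Σ A.Δ λ y → Z y y' × A.rol r x y
      B5  : T fI → ∀ {x x' y} r → Z x x' → A.rol r y x →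
              Σ B.Δ λ y' → Z y y' × B.rol r y' x'
      B6  : T fI → ∀ {x x' y'} r → Z x x' → B.rol r y' x' →
              Σ A.Δ λ y → Z y y' × A.rol r y x
      B7  : T fO → ∀ {x x'} → Z x x' → ∀ a → (x ≡ A.ind a) ⇔ (x' ≡ B.ind a)
      B8  : T fQ → ∀ {x x'} → Z x x' → ∀ r →
              Σ (Succ x r ⤖ Succ' x' r) λ h →
                ∀ p → Z (proj₁ p) (proj₁ (Function.Bundles.Bijection.to h p))
      B9  : T fQ → T fI → ∀ {x x'} → Z x x' → ∀ r →
              Σ (Pred x r ⤖ Pred' x' r) λ h →
                ∀ p → Z (proj₁ p) (proj₁ (Function.Bundles.Bijection.to h p))
      B10 : T fU → ∀ x → Σ B.Δ λ x' → Z x x'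
      B11 : T fU → ∀ x' → Σ A.Δ λ x → Z x x'
      B12 : T fSelf → ∀ {x x'} → Z x x' → ∀ r → A.rol r x x ⇔ B.rol r x' x'

  -- ∼_{Φ,I}: the largest L_Φ-bisimulation between I and itself
  -- (the union of all L_Φ-bisimulations)
  Bisimilar : ∀ {ℓ} (I : Interp S ℓ) → Interp.Δ I → Interp.Δ I → Set (lsuc ℓ)
  Bisimilar {ℓ} I x y = Σ (Interp.Δ I → Interp.Δ I → Set ℓ) λ Z → IsBisim I I Z × Z x y

  NoUnreachable : ∀ {ℓ} → Interp S ℓ → Set ℓ
  NoUnreachable I = ∀ x → Σ (IName S) λ a →
    Star (λ u v → Σ (Basic S Φ) λ R → basicRel {Φ = Φ} I R u v) (Interp.ind I a) x

  -- J is (a presentation of) the quotient QS-interpretation I /^QS_{∼Φ,I},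
  -- with π x playing the role of the class [x]
  record IsQSQuotient {ℓ ℓJ} (I : Interp S ℓ) (J : QSInterp S Φ ℓJ)
         (π : Interp.Δ I → QSInterp.Δ J) : Set (lsuc ℓ ⊔ ℓJ) where
    private
      module A = Interp I
      module B = QSInterp J
    _∼_ : A.Δ → A.Δ → Set (lsuc ℓ)
    x ∼ y = Bisimilar I x y
    field
      π-surj : ∀ z → Σ A.Δ λ x → π x ≡ z
      π-ker  : ∀ x y → (π x ≡ π y) ⇔ (x ∼ y)
      q-ind  : ∀ a → B.ind a ≡ π (A.ind a)
      q-con  : ∀ A z → B.con A z ⇔ (Σ A.Δ λ x → π x ≡ z × A.con A x)
      q-rol  : ∀ r z w → B.rol r z w ⇔
                 (Σ A.Δ λ x → Σ A.Δ λ y → π x ≡ z × π y ≡ w × A.rol r x y)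
      -- QU(R)([x],[y]) = max_{x' ∈ [x]} #{y' ∈ [y] : (x',y') ∈ R}
      q-QU-ub : ∀ R x y x' → x' ∼ x → ∀ ys → Unique ys →
                 All (λ y' → y' ∼ y × basicRel {Φ = Φ} I R x' y') ys →
                 length ys ≤ B.QU R (π x) (π y)
      q-QU-att : ∀ R x y → Σ A.Δ λ x' → x' ∼ x × Σ (List A.Δ) λ ys → Unique ys ×
                 All (λ y' → y' ∼ y × basicRel {Φ = Φ} I R x' y') ys ×
                 length ys ≡ B.QU R (π x) (π y)
      q-SE   : ∀ r z → B.SE r z ⇔ (Σ A.Δ λ x → π x ≡ z × A.rol r x x)

  FiniteQS : ∀ {ℓ} → QSInterp S Φ ℓ → Set ℓ
  FiniteQS J = Σ (List (QSInterp.Δ J)) λ zs → ∀ z → z ∈ zs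

  FinBranchingQS : ∀ {ℓ} → QSInterp S Φ ℓ → Set ℓ
  FinBranchingQS J = ∀ (R : Basic S Φ) x → Σ (List (QSInterp.Δ J)) λ zs →
    ∀ y → basicRel {Φ = Φ} (QSInterp.base J) R x y → y ∈ zs

module Submission where

open import Defs
open import Level using (Level)
open import Data.Product using (_×_)
open import Axiom.ExcludedMiddle using (ExcludedMiddle)

open import Level using (_⊔_)
open import Function using (_∘_; id)
open import Function.Bundles using (_⇔_; mk⇔; _⤖_; mk⤖; Bijection; Equivalence)
open import Function.Definitions using (Injective)
import Function.Properties.Equivalence as ⇔
open import Data.Empty using (⊥-elim)
open import Data.Empty.Polymorphic using () renaming (⊥-elim to ⊥ₚ-elim)
open import Data.Bool using (Bool; true; false; T)
open import Data.Maybe using (Maybe; just; nothing)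
open import Data.Sum using (inj₁; inj₂; [_,_])
open import Data.Product using (Σ; _,_; proj₁; proj₂)
open import Data.Nat using (ℕ; zero; suc; _+_; _≤_; _<_; z≤n; s≤s)
open import Data.Nat.Properties
  using (≤-refl; ≤-trans; ≤-pred; +-mono-≤; +-suc; +-comm; +-identityʳ; <-cmp; n≮n; m≤n⇒m<n∨m≡n; module ≤-Reasoning)
open import Data.Nat.ListAction using (sum)
open import Data.List using (List; []; _∷_; length; map; filter; _++_; foldr; concatMap; upTo; allFin; deduplicate)
open import Data.List.Properties using (filter-all; filter-notAll; length-map; length-upTo; length-++)
open import Data.List.Relation.Unary.Any using (here; there)
import Data.List.Relation.Unary.Any as Any
import Data.List.Relation.Unary.Any.Properties as AnyP
open import Data.List.Relation.Unary.All using (All; []; _∷_)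
import Data.List.Relation.Unary.All as All
open import Data.List.Relation.Unary.All.Properties
  using (¬Any⇒All¬) renaming (++⁺ to All-++⁺; map⁺ to All-map⁺; map⁻ to All-map⁻)
open import Data.List.Membership.Propositional using (_∈_; _∉_; mapWith∈)
open import Data.List.Membership.Propositional.Properties
  using (∈-map⁺; ∈-map⁻; ∈-filter⁺; ∈-filter⁻; ∈-++⁺ˡ; ∈-++⁺ʳ; ∈-concatMap⁺; ∈-allFin; ∈-deduplicate⁺; ∈-deduplicate⁻)
open import Data.List.Membership.Setoid.Properties using (length-mapWith∈)
open import Data.List.Relation.Binary.Subset.Propositional using (_⊆_)
open import Data.List.Relation.Unary.Unique.Propositional using (Unique; []; _∷_)
open import Data.List.Relation.Unary.Unique.Propositional.Properties using (filter⁺; map⁺; upTo⁺; ++⁺)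
open import Data.List.Relation.Unary.Unique.DecPropositional.Properties using (deduplicate-!)
open import Relation.Nullary using (¬_; Dec; yes; no; ¬?; Irrelevant)
open import Relation.Nullary.Decidable using (decidable-stable)
open import Relation.Unary using (Pred; Decidable)
open import Relation.Unary.Properties using (∁?)
open import Relation.Binary.Definitions using (DecidableEquality; tri<; tri≈; tri>)
open import Relation.Binary.Structures using (IsEquivalence)
open import Relation.Binary.Construct.Closure.ReflexiveTransitive using (Star; ε; _◅_)
open import Relation.Binary.PropositionalEquality
  using (_≡_; _≢_; refl; sym; trans; cong; cong₂; subst; subst₂; setoid)

-- (i) Truth lemma: x satisfies C in I iff its class πx satisfies C in J.
--     Number restrictions transfer because QU counts successors per class and,
--     with Q, bisimilar elements have bijective successors.  So J has the same
--     axioms and assertions as I.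
-- (ii) Hennessy–Milner: if J is finitely branching, every element of I has
--     finitely many successors, and indistinguishability by concepts is an
--     L_Φ-bisimulation (its counting clause via a greedy matching of successor
--     lists); so indistinguishable elements of I share a class.
-- (iii) Hence each finite list of classes has characteristic concepts ψ z, true
--     at a representative of z and pairwise jointly unsatisfiable.  If every
--     concept satisfiable in I is satisfiable in K ("K realises I", which follows
--     from equal axioms, or from equal assertions without unreachable objects),
--     witnesses of the ψ z embed every list of classes injectively into K.
-- (iv) A set all of whose lists embed into K embeds into K when it is finite or
--     countable: if infinite, K is infinite too and receives ℕ.  J is finite in
--     (1) and, exhausted by breadth-first search from the named classes,
--     countable in (2).

module ListFacts where

  length-partition-≡ : ∀ {a p} {A : Set a} {P : Pred A p} (P? : Decidable P) xs →
    length xs ≡ length (filter P? xs) + length (filter (∁? P?) xs)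
  length-partition-≡ P? [] = refl
  length-partition-≡ P? (x ∷ xs) with P? x
  ... | yes _ = cong suc (length-partition-≡ P? xs)
  ... | no _ = trans (cong suc (length-partition-≡ P? xs)) (sym (+-suc _ _))

  unique-key : ∀ {a b} {A : Set a} {B : Set b} (f : B → A) {P : List B} →
    Unique (map f P) → ∀ {q q'} → q ∈ P → q' ∈ P → f q ≡ f q' → q ≡ q'
  unique-key f (_ ∷ _) (here refl) (here refl) _ = refl
  unique-key f (p∉ ∷ _) (here refl) (there q'∈P) eq = ⊥-elim (All.lookup p∉ (∈-map⁺ f q'∈P) eq)
  unique-key f (p∉ ∷ _) (there q∈P) (here refl) eq = ⊥-elim (All.lookup p∉ (∈-map⁺ f q∈P) (sym eq))
  unique-key f (_ ∷ u) (there q∈P) (there q'∈P) eq = unique-key f u q∈P q'∈P eq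

  subtype-≡ : ∀ {a p} {A : Set a} {Q : A → Set p} → (∀ x → Irrelevant (Q x)) →
    ∀ {x y} {qx : Q x} {qy : Q y} → x ≡ y → (x , qx) ≡ (y , qy)
  subtype-≡ Q-irr refl = cong (_ ,_) (Q-irr _ _ _)

  transport : ∀ {a p q q'} {A : Set a} {Pa Pb : A → Set p} {Q : A → Set q} {Q' : A → Set q'} →
    (∀ x → Irrelevant (Pb x)) → (h : Σ A Pa → Σ A Pb) → Injective _≡_ _≡_ h →
    (∀ r → Q (proj₁ r) → Q' (proj₁ (h r))) →
    ∀ ys → Unique ys → All (λ y → Q y × Pa y) ys →
    Σ (List A) λ zs → Unique zs × All (λ z → Q' z × Pb z) zs × length zs ≡ length ys
  transport {A = A} {Pa} {Pb} {Q} {Q'} Pb-irr h h-inj Q⇒Q' ys uys Qys =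
    images ys Qys , images-unique ys uys Qys , images-All ys Qys , images-length ys Qys
    where
    images : ∀ ys → All (λ y → Q y × Pa y) ys → List A
    images [] [] = []
    images (y ∷ ys) ((_ , py) ∷ ps) = proj₁ (h (y , py)) ∷ images ys ps

    images-All : ∀ ys ps → All (λ z → Q' z × Pb z) (images ys ps)
    images-All [] [] = []
    images-All (y ∷ ys) ((qy , py) ∷ ps) = (Q⇒Q' (y , py) qy , proj₂ (h (y , py))) ∷ images-All ys ps

    images-length : ∀ ys ps → length (images ys ps) ≡ length ys
    images-length [] [] = refl
    images-length (y ∷ ys) (_ ∷ ps) = cong suc (images-length ys ps)

    images-∈ : ∀ {z} ys ps → z ∈ images ys ps → Σ (Σ A Pa) λ r → proj₁ r ∈ ys × proj₁ (h r) ≡ z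
    images-∈ (y ∷ ys) ((_ , py) ∷ ps) (here refl) = (y , py) , here refl , refl
    images-∈ (y ∷ ys) (_ ∷ ps) (there z∈) =
      let (r , r∈ys , hr≡z) = images-∈ ys ps z∈ in r , there r∈ys , hr≡z

    images-unique : ∀ ys → Unique ys → ∀ ps → Unique (images ys ps)
    images-unique [] [] [] = []
    images-unique (y ∷ ys) (y∉ys ∷ uys) ((_ , py) ∷ ps) =
      All.tabulate (λ z∈ hy≡z → let (r , r∈ys , hr≡z) = images-∈ ys ps z∈ in
        All.lookup y∉ys (subst (_∈ ys)
          (sym (cong proj₁ (h-inj (subtype-≡ Pb-irr (trans hy≡z (sym hr≡z)))))) r∈ys) refl) ∷
      images-unique ys uys ps

  mapWith∈-unique : ∀ {a b} {A : Set a} {B : Set b} (xs : List A) (g : ∀ {x} → x ∈ xs → B) →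
    (∀ {x y} (x∈ : x ∈ xs) (y∈ : y ∈ xs) → g x∈ ≡ g y∈ → x ≡ y) →
    Unique xs → Unique (mapWith∈ xs g)
  mapWith∈-unique [] g g-inj [] = []
  mapWith∈-unique (x ∷ xs) g g-inj (x∉xs ∷ uxs) =
    All.tabulate (λ b∈ gx≡b → let (y , y∈xs , b≡gy) = AnyP.mapWith∈⁻ xs (λ y∈ → g (there y∈)) b∈ in
      All.lookup x∉xs (subst (_∈ xs) (sym (g-inj (here refl) (there y∈xs) (trans gx≡b b≡gy))) y∈xs) refl) ∷
    mapWith∈-unique xs (λ y∈ → g (there y∈)) (λ x∈ y∈ → g-inj (there x∈) (there y∈)) uxs

  module _ {a} {A : Set a} (_≟_ : DecidableEquality A) where

    remove : A → List A → List A
    remove x = filter (λ y → ¬? (y ≟ x))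

    ∈-remove⁺ : ∀ {x y ys} → y ∈ ys → y ≢ x → y ∈ remove x ys
    ∈-remove⁺ = ∈-filter⁺ _

    ∈-remove⁻ : ∀ {x y} ys → y ∈ remove x ys → y ∈ ys × y ≢ x
    ∈-remove⁻ _ = ∈-filter⁻ _

    remove-unique : ∀ {x ys} → Unique ys → Unique (remove x ys)
    remove-unique = filter⁺ _

    remove-shortens : ∀ {x ys} → x ∈ ys → length (remove x ys) < length ys
    remove-shortens {x} {ys} x∈ys =
      filter-notAll _ ys (Any.map (λ x≡y y≢x → y≢x (sym x≡y)) x∈ys)

    remove-length : ∀ {x ys} → Unique ys → length ys ≤ suc (length (remove x ys))
    remove-length {x} {[]} [] = z≤n
    remove-length {x} {y ∷ ys} (y∉ys ∷ u) with y ≟ x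
    ... | yes refl rewrite filter-all (λ z → ¬? (z ≟ y)) (All.map (λ y≢z z≡y → y≢z (sym z≡y)) y∉ys) = ≤-refl
    ... | no _ = s≤s (remove-length u)

    unique-⊆-length : ∀ {xs ys} → Unique xs → xs ⊆ ys → length xs ≤ length ys
    unique-⊆-length {[]} _ _ = z≤n
    unique-⊆-length {x ∷ xs} {ys} (x∉xs ∷ u) sub =
      ≤-trans (s≤s (unique-⊆-length u xs⊆ys-x)) (remove-shortens (sub (here refl)))
      where
      xs⊆ys-x : xs ⊆ remove x ys
      xs⊆ys-x {y} y∈xs = ∈-remove⁺ (sub (there y∈xs)) λ { refl → All.lookup x∉xs y∈xs refl }

-- Matching the elements of two duplicate-free lists along a decidable
-- equivalence E, when each E-class is at least as large in either list as in
-- the other; the matching then yields an E-respecting bijection.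
module Matching {a e} {A : Set a} (_≟_ : DecidableEquality A)
  (E : A → A → Set e) (E? : ∀ x y → Dec (E x y)) (E-equiv : IsEquivalence E) where

  open ListFacts
  open IsEquivalence E-equiv using () renaming (refl to E-refl; sym to E-sym; trans to E-trans)

  Dominated : List A → List A → Set (a ⊔ e)
  Dominated La Lb = ∀ y F → Unique F → F ⊆ La → All (E y) F →
    Σ (List A) λ G → Unique G × G ⊆ Lb × All (E y) G × length F ≤ length G

  dominated-mono : ∀ {La La' Lb Lb'} → La' ⊆ La → Lb ⊆ Lb' →
    Dominated La Lb → Dominated La' Lb'
  dominated-mono La'⊆La Lb⊆Lb' dom y F uF F⊆La' EF
    with dom y F uF (La'⊆La ∘ F⊆La') EF
  ... | G , uG , G⊆Lb , EG , F≤G = G , uG , Lb⊆Lb' ∘ G⊆Lb , EG , F≤G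

  dominated-remove : ∀ {La Lb x x'} → x ∈ La → E x x' →
    Dominated La Lb → Dominated (remove _≟_ x La) (remove _≟_ x' Lb)
  dominated-remove {La} {x = x} {x'} x∈La Exx' dom y F uF F⊆ EF with E? y x
  ... | yes Eyx with dom y (x ∷ F) (x∉F ∷ uF) x∷F⊆La (Eyx ∷ EF)
    where
    x∉F : All (x ≢_) F
    x∉F = All.tabulate λ z∈F x≡z → proj₂ (∈-remove⁻ _≟_ La (F⊆ z∈F)) (sym x≡z)
    x∷F⊆La : x ∷ F ⊆ La
    x∷F⊆La (here refl) = x∈La
    x∷F⊆La (there z∈F) = proj₁ (∈-remove⁻ _≟_ La (F⊆ z∈F))
  ... | G , uG , G⊆Lb , EG , F<G =
    remove _≟_ x' G , remove-unique _≟_ uG ,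
    (λ z∈ → let (z∈G , z≢x') = ∈-remove⁻ _≟_ G z∈ in ∈-remove⁺ _≟_ (G⊆Lb z∈G) z≢x') ,
    All.tabulate (λ z∈ → All.lookup EG (proj₁ (∈-remove⁻ _≟_ G z∈))) ,
    ≤-pred (≤-trans F<G (remove-length _≟_ uG))
  dominated-remove {La} {x = x} {x'} x∈La Exx' dom y F uF F⊆ EF | no ¬Eyx
    with dom y F uF (proj₁ ∘ ∈-remove⁻ _≟_ La ∘ F⊆) EF
  ... | G , uG , G⊆Lb , EG , F≤G =
    G , uG ,
    (λ z∈G → ∈-remove⁺ _≟_ (G⊆Lb z∈G)
               λ { refl → ¬Eyx (E-trans (All.lookup EG z∈G) (E-sym Exx')) }) ,
    EG , F≤G

  Matching : List A → List A → Set (a ⊔ e)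
  Matching La Lb = Σ (List (A × A)) λ P →
    map proj₁ P ≡ La × Unique (map proj₂ P) ×
    map proj₂ P ⊆ Lb × Lb ⊆ map proj₂ P × All (λ q → E (proj₁ q) (proj₂ q)) P

  -- greedy matching: pair the head of La with any related element of Lb
  match : ∀ La Lb → Unique La → Dominated La Lb → Dominated Lb La → Matching La Lb
  match [] Lb _ _ dom⁻ = [] , refl , [] , (λ ()) , Lb-empty , []
    where
    Lb-empty : Lb ⊆ []
    Lb-empty {b} b∈Lb with dom⁻ b (b ∷ []) ([] ∷ []) (λ { (here refl) → b∈Lb }) (E-refl ∷ [])
    ... | [] , _ , _ , _ , ()
    ... | g ∷ _ , _ , G⊆[] , _ , _ with G⊆[] (here refl)
    ... | ()
  match (x ∷ La) Lb (x∉La ∷ uLa) dom dom⁻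
    with dom x (x ∷ []) ([] ∷ []) (λ { (here refl) → here refl }) (E-refl ∷ [])
  ... | [] , _ , _ , _ , ()
  ... | x' ∷ _ , _ , G⊆Lb , (Exx' ∷ _) , _
    with match La (remove _≟_ x' Lb) uLa
           (dominated-mono La⊆ id (dominated-remove (here refl) Exx' dom))
           (dominated-mono id ⊆La (dominated-remove (G⊆Lb (here refl)) (E-sym Exx') dom⁻))
    where
    La⊆ : La ⊆ remove _≟_ x (x ∷ La)
    La⊆ z∈La = ∈-remove⁺ _≟_ (there z∈La) λ { refl → All.lookup x∉La z∈La refl }
    ⊆La : remove _≟_ x (x ∷ La) ⊆ La
    ⊆La z∈ with ∈-remove⁻ _≟_ (x ∷ La) z∈
    ... | here refl , z≢x = ⊥-elim (z≢x refl)
    ... | there z∈La , _ = z∈La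
  ... | P , P₁≡La , uP₂ , P₂⊆ , ⊆P₂ , EP =
    (x , x') ∷ P , cong (x ∷_) P₁≡La ,
    All.tabulate (λ z∈P₂ z≡x' → proj₂ (∈-remove⁻ _≟_ Lb (P₂⊆ z∈P₂)) (sym z≡x')) ∷ uP₂ ,
    (λ { (here refl) → G⊆Lb (here refl) ; (there z∈P₂) → proj₁ (∈-remove⁻ _≟_ Lb (P₂⊆ z∈P₂)) }) ,
    Lb⊆ , Exx' ∷ EP
    where
    Lb⊆ : Lb ⊆ x' ∷ map proj₂ P
    Lb⊆ {z} z∈Lb with z ≟ x'
    ... | yes refl = here refl
    ... | no z≢x' = there (⊆P₂ (∈-remove⁺ _≟_ z∈Lb z≢x'))

  module _ {p} {Pa Pb : A → Set p}
    (Pa-irr : ∀ x → Irrelevant (Pa x)) (Pb-irr : ∀ x → Irrelevant (Pb x))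
    {La Lb : List A} (uLa : Unique La)
    (La-enum : ∀ {x} → x ∈ La ⇔ Pa x) (Lb-enum : ∀ {x} → x ∈ Lb ⇔ Pb x) where

    matching⇒bijection : Matching La Lb →
      Σ (Σ A Pa ⤖ Σ A Pb) λ h → ∀ r → E (proj₁ r) (proj₁ (Bijection.to h r))
    matching⇒bijection (P , P₁≡La , uP₂ , P₂⊆Lb , Lb⊆P₂ , EP) =
      mk⤖ {to = forward} (forward-injective , forward-surjective) , forward-E
      where
      open Equivalence

      pairOf : ∀ {x} → Pa x → Σ (A × A) λ q → q ∈ P × x ≡ proj₁ q
      pairOf px = ∈-map⁻ proj₁ (subst (_ ∈_) (sym P₁≡La) (from La-enum px))

      forward : Σ A Pa → Σ A Pb
      forward (x , px) with pairOf px
      ... | q , q∈P , _ = proj₂ q , to Lb-enum (P₂⊆Lb (∈-map⁺ proj₂ q∈P))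

      forward-E : ∀ r → E (proj₁ r) (proj₁ (forward r))
      forward-E (x , px) with pairOf px
      ... | q , q∈P , refl = All.lookup EP q∈P

      forward-injective : ∀ {r s} → forward r ≡ forward s → r ≡ s
      forward-injective {x , px} {y , py} eq with pairOf px | pairOf py
      ... | q , q∈P , refl | q' , q'∈P , refl =
        subtype-≡ Pa-irr (cong proj₁ (unique-key proj₂ uP₂ q∈P q'∈P (cong proj₁ eq)))

      forward-surjective : ∀ s → Σ (Σ A Pa) λ r → ∀ {r'} → r' ≡ r → forward r' ≡ s
      forward-surjective (y , py) with ∈-map⁻ proj₂ (Lb⊆P₂ (from Lb-enum py))
      ... | q , q∈P , refl = preimage , λ { refl → hits }
        where
        preimage : Σ A Pa
        preimage = proj₁ q , to La-enum (subst (_ ∈_) P₁≡La (∈-map⁺ proj₁ q∈P))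
        hits : forward preimage ≡ (proj₂ q , py)
        hits with pairOf (proj₂ preimage)
        ... | q' , q'∈P , eq =
          subtype-≡ Pb-irr (cong proj₂ (unique-key proj₁ (subst Unique (sym P₁≡La) uLa) q'∈P q∈P (sym eq)))

module _ {d} (D : Set d) where

  Finite : Set d
  Finite = Σ (List D) λ zs → ∀ z → z ∈ zs

  Embedding : ∀ {k} (K : Set k) → Set (d ⊔ k)
  Embedding K = Σ (D → K) (Injective _≡_ _≡_)

  ListEmbedding : ∀ {k} → List D → (K : Set k) → Set (d ⊔ k)
  ListEmbedding zs K = Σ (∀ {z} → z ∈ zs → K) λ g →
    ∀ {z w} (z∈ : z ∈ zs) (w∈ : w ∈ zs) → g z∈ ≡ g w∈ → z ≡ w

  record Exhaustion : Set d where
    field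
      stage  : ℕ → List D
      grows  : ∀ n → Σ (List D) λ new → stage (suc n) ≡ stage n ++ new
      covers : ∀ z → Σ ℕ λ n → z ∈ stage n

_∘ₑ_ : ∀ {a b c} {A : Set a} {B : Set b} {C : Set c} →
  Embedding B C → Embedding A B → Embedding A C
(g , g-inj) ∘ₑ (f , f-inj) = g ∘ f , f-inj ∘ g-inj

-- a set exhausted by a chain of finite lists is countable: number an element
-- by its position in the first stage containing it; positions never change
-- since later stages only append
exhaustion⇒ℕ-embedding : ∀ {d} {D : Set d} → Exhaustion D → Embedding D ℕ
exhaustion⇒ℕ-embedding {D = D} exh = position , position-injective
  where
  open Exhaustion exh

  _at_ : List D → ℕ → Maybe D
  [] at _ = nothing
  (x ∷ _) at zero = just x
  (_ ∷ xs) at suc i = xs at i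

  at-++ : ∀ xs ys {i v} → xs at i ≡ just v → (xs ++ ys) at i ≡ just v
  at-++ (_ ∷ xs) ys {zero} eq = eq
  at-++ (_ ∷ xs) ys {suc i} eq = at-++ xs ys eq

  index : ∀ {v} xs → v ∈ xs → Σ ℕ λ i → xs at i ≡ just v
  index (_ ∷ xs) (here refl) = zero , refl
  index (_ ∷ xs) (there v∈xs) = let (i , eq) = index xs v∈xs in suc i , eq

  at-later : ∀ m n {i v} → stage n at i ≡ just v → stage (m + n) at i ≡ just v
  at-later zero n eq = eq
  at-later (suc m) n eq with grows (m + n)
  ... | new , grown rewrite grown = at-++ (stage (m + n)) new (at-later m n eq)

  position : D → ℕ
  position z = let (n , z∈) = covers z in proj₁ (index (stage n) z∈)

  position-injective : ∀ {z w} → position z ≡ position w → z ≡ w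
  position-injective {z} {w} eq with covers z | covers w
  ... | n , z∈ | m , w∈ with index (stage n) z∈ | index (stage m) w∈
  ... | i , z-at | j , w-at = just-injective (trans (sym z-at') w-at')
    where
    just-injective : ∀ {x y : D} → just x ≡ just y → x ≡ y
    just-injective refl = refl
    z-at' : stage (m + n) at i ≡ just z
    z-at' = at-later m n z-at
    w-at' : stage (m + n) at i ≡ just w
    w-at' = subst₂ (λ k l → stage k at l ≡ just w) (+-comm n m) (sym eq) (at-later n m w-at)

module Classical (em : ∀ {ℓ} → ExcludedMiddle ℓ) where

  open ListFacts

  byContradiction : ∀ {ℓ} {P : Set ℓ} → ¬ ¬ P → P
  byContradiction = decidable-stable em

  _≟_ : ∀ {a} {A : Set a} → DecidableEquality A
  _ ≟ _ = em

  -- a predicate all of whose duplicate-free lists have length at most N is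
  -- enumerated by one duplicate-free list: add fresh elements while possible
  enumerate-bounded : ∀ {a p} {A : Set a} (P : A → Set p) (N : ℕ) →
    (∀ ys → Unique ys → All P ys → length ys ≤ N) →
    Σ (List A) λ L → Unique L × All P L × (∀ y → P y → y ∈ L)
  enumerate-bounded {A = A} P N bounded = grow (suc N) [] [] [] refl
    where
    grow : ∀ fuel L → Unique L → All P L → length L + fuel ≡ suc N →
      Σ (List A) λ L → Unique L × All P L × (∀ y → P y → y ∈ L)
    grow fuel L uL PL len with em {P = Σ A λ y → P y × y ∉ L}
    ... | no no-fresh =
      L , uL , PL , λ y Py → byContradiction λ y∉L → no-fresh (y , Py , y∉L)
    grow zero L uL PL len | yes _ =
      ⊥-elim (n≮n N (subst (_≤ N) (trans (sym (+-identityʳ (length L))) len) (bounded L uL PL)))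
    grow (suc fuel) L uL PL len | yes (y , Py , y∉L) =
      grow fuel (y ∷ L) (¬Any⇒All¬ L y∉L ∷ uL) (Py ∷ PL) (trans (sym (+-suc (length L) fuel)) len)

  module _ {d} {D : Set d} where

    -- an infinite set contains an injective sequence: keep choosing elements
    -- outside the finite list of those chosen before
    infinite⇒ℕ-embedding : ¬ Finite D → Embedding ℕ D
    infinite⇒ℕ-embedding infinite = next , next-injective
      where
      fresh : (L : List D) → Σ D (_∉ L)
      fresh L = byContradiction λ none →
        infinite (L , λ z → byContradiction λ z∉L → none (z , z∉L))

      chosen : ℕ → List D
      chosen zero = []
      chosen (suc n) = proj₁ (fresh (chosen n)) ∷ chosen n

      next : ℕ → D
      next n = proj₁ (fresh (chosen n))

      chosen-later : ∀ {m n} → m < n → next m ∈ chosen n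
      chosen-later {m} {suc n} (s≤s m≤n) with m≤n⇒m<n∨m≡n m≤n
      ... | inj₁ m<n = there (chosen-later m<n)
      ... | inj₂ refl = here refl

      next-injective : ∀ {m n} → next m ≡ next n → m ≡ n
      next-injective {m} {n} eq with <-cmp m n
      ... | tri< m<n _ _ = ⊥-elim (proj₂ (fresh (chosen n)) (subst (_∈ chosen n) eq (chosen-later m<n)))
      ... | tri≈ _ m≡n _ = m≡n
      ... | tri> _ _ n<m = ⊥-elim (proj₂ (fresh (chosen m)) (subst (_∈ chosen m) (sym eq) (chosen-later n<m)))

    long-lists⇒infinite : (∀ n → Σ (List D) λ zs → Unique zs × length zs ≡ n) → ¬ Finite D
    long-lists⇒infinite long (zs , all∈) with long (suc (length zs))
    ... | ys , uys , len = n≮n _ (subst (_≤ length zs) len (unique-⊆-length _≟_ uys λ {y} _ → all∈ y))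

  ℕ-embedding⇒long-lists : ∀ {d} {D : Set d} → Embedding ℕ D →
    ∀ n → Σ (List D) λ zs → Unique zs × length zs ≡ n
  ℕ-embedding⇒long-lists (f , f-inj) n =
    map f (upTo n) , map⁺ f-inj (upTo⁺ n) , trans (length-map f (upTo n)) (length-upTo n)

  -- D embeds into K as soon as every list of D embeds into K, provided D is
  -- countable when infinite: a finite D is one list, and an infinite D makes K
  -- infinite, hence receiving ℕ
  embedding-from-lists : ∀ {d k} {D : Set d} {K : Set k} →
    (∀ zs → ListEmbedding D zs K) → (¬ Finite D → Embedding D ℕ) → Embedding D K
  embedding-from-lists {D = D} pieces countable with em {P = Finite D}
  ... | yes (zs , all∈) with pieces zs
  ...   | g , g-inj = (λ z → g (all∈ z)) , λ {z} {w} → g-inj (all∈ z) (all∈ w)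
  embedding-from-lists {K = K} pieces countable | no infinite =
    infinite⇒ℕ-embedding (long-lists⇒infinite K-long) ∘ₑ countable infinite
    where
    K-long : ∀ n → Σ (List K) λ ks → Unique ks × length ks ≡ n
    K-long n with ℕ-embedding⇒long-lists (infinite⇒ℕ-embedding infinite) n
    ... | zs , uzs , refl with pieces zs
    ... | g , g-inj = mapWith∈ zs g , mapWith∈-unique zs g g-inj uzs , length-mapWith∈ (setoid _) zs

module _ {S : Sig} {Φ : Feats} where

  open Feats Φ

  roleOf : Basic S Φ → Role S Φ
  roleOf (bn r) = rn r
  roleOf (bi i r) = inv i (rn r)

  atLeast : T fQ → ℕ → Basic S Φ → Concept S Φ → Concept S Φ
  atLeast qQ n (bn r) C = geq qQ n r C
  atLeast qQ n (bi i r) C = geqInv qQ i n r C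

  exPath : List (Basic S Φ) → Concept S Φ → Concept S Φ
  exPath [] C = C
  exPath (R ∷ Rs) C = ex (roleOf R) (exPath Rs C)

  ⨅ : List (Concept S Φ) → Concept S Φ
  ⨅ = foldr _⊓c_ top

  ⨅-intro : ∀ {ℓ} (I : Interp S ℓ) Cs {x} → All (λ C → ⟦_⟧ᵀ I C x) Cs → ⟦_⟧ᵀ I (⨅ Cs) x
  ⨅-intro I [] [] = _
  ⨅-intro I (C ∷ Cs) (Cx ∷ Csx) = Cx , ⨅-intro I Cs Csx

  ⨅-elim : ∀ {ℓ} (K : QSInterp S Φ ℓ) Cs {k} → ⟦_⟧ᵠ K (⨅ Cs) k → All (λ C → ⟦_⟧ᵠ K C k) Cs
  ⨅-elim K [] _ = []
  ⨅-elim K (C ∷ Cs) (Ck , Csk) = Ck ∷ ⨅-elim K Cs Csk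

  inverseRoles : (b : Bool) → (T b → RName S → Basic S Φ) → List (Basic S Φ)
  inverseRoles true inverse = map (inverse _) (allFin _)
  inverseRoles false _ = []

  basicRoles : List (Basic S Φ)
  basicRoles = map bn (allFin _) ++ inverseRoles fI bi

  ∈-basicRoles : ∀ R → R ∈ basicRoles
  ∈-basicRoles (bn r) = ∈-++⁺ˡ (∈-map⁺ bn (∈-allFin r))
  ∈-basicRoles (bi i r) = ∈-++⁺ʳ _ (∈-inverseRoles fI bi i)
    where
    ∈-inverseRoles : ∀ b (inverse : T b → RName S → Basic S Φ) (i : T b) → inverse i r ∈ inverseRoles b inverse
    ∈-inverseRoles true inverse i = ∈-map⁺ (inverse i) (∈-allFin r)

  BasicStep : ∀ {ℓ} (I : Interp S ℓ) → Interp.Δ I → Interp.Δ I → Set ℓ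
  BasicStep I u v = Σ (Basic S Φ) λ R → basicRel {Φ = Φ} I R u v

  module _ {ℓ} (I : Interp S ℓ) where

    roleOf⁺ : ∀ R {x y} → basicRel {Φ = Φ} I R x y → ⟦_⟧ᵀR I (roleOf R) x y
    roleOf⁺ (bn r) t = t
    roleOf⁺ (bi i r) t = t

    roleOf⁻ : ∀ R {x y} → ⟦_⟧ᵀR I (roleOf R) x y → basicRel {Φ = Φ} I R x y
    roleOf⁻ (bn r) t = t
    roleOf⁻ (bi i r) t = t

    atLeast⁺ : ∀ qQ n R C {x} → geqT {Φ = Φ} I n R (⟦_⟧ᵀ I C) x → ⟦_⟧ᵀ I (atLeast qQ n R C) x
    atLeast⁺ qQ n (bn r) C c = c
    atLeast⁺ qQ n (bi i r) C c = c

    atLeast⁻ : ∀ qQ n R C {x} → ⟦_⟧ᵀ I (atLeast qQ n R C) x → geqT {Φ = Φ} I n R (⟦_⟧ᵀ I C) x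
    atLeast⁻ qQ n (bn r) C c = c
    atLeast⁻ qQ n (bi i r) C c = c

  Realises : ∀ {ℓ ℓK} → Interp S ℓ → QSInterp S Φ ℓK → Set (ℓ ⊔ ℓK)
  Realises I K = ∀ C x → ⟦_⟧ᵀ I C x → Σ (QSInterp.Δ K) (⟦_⟧ᵠ K C)

  -- the same terminological axioms: if C held nowhere in K, then K and hence
  -- I would validate C ⊑ ⊥
  sameTBox⇒realises : (∀ {ℓ} → ExcludedMiddle ℓ) →
    ∀ {ℓ ℓK} {I : Interp S ℓ} {K : QSInterp S Φ ℓK} → SameTBox I K → Realises I K
  sameTBox⇒realises em same C x Cx = Classical.byContradiction em λ nowhere →
    ⊥ₚ-elim (Equivalence.from (same C bot) (λ k Ck → ⊥-elim (nowhere (k , Ck))) x Cx)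

  -- the same concept assertions, in an I without unreachable objects: if C
  -- holds at x, reached from a along R₁⋯Rₙ, then (∃R₁.⋯∃Rₙ.C)(a) holds in I,
  -- hence in K, whose path then ends in an element satisfying C
  sameABox⇒realises : ∀ {ℓ ℓK} {I : Interp S ℓ} {K : QSInterp S Φ ℓK} →
    NoUnreachable Φ I → SameABox I K → Realises I K
  sameABox⇒realises {I = I} {K} reach same C x Cx with reach x
  ... | a , path = endpoint (labels path) C _
                     (Equivalence.to (same (exPath (labels path) C) a) (along path Cx))
    where
    labels : ∀ {u v} → Star (BasicStep I) u v → List (Basic S Φ)
    labels ε = []
    labels ((R , _) ◅ path) = R ∷ labels path

    along : ∀ {u v} (path : Star (BasicStep I) u v) → ⟦_⟧ᵀ I C v → ⟦_⟧ᵀ I (exPath (labels path) C) u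
    along ε Cv = Cv
    along (_◅_ {j = w} (R , t) path) Cv = w , roleOf⁺ I R t , along path Cv

    endpoint : ∀ Rs C k → ⟦_⟧ᵠ K (exPath Rs C) k → Σ (QSInterp.Δ K) (⟦_⟧ᵠ K C)
    endpoint [] C k Ck = k , Ck
    endpoint (R ∷ Rs) C k (k' , _ , Ck') = endpoint Rs C k' Ck'

module Quotient (em : ∀ {ℓ} → ExcludedMiddle ℓ) {S : Sig} (Φ : Feats) {ℓ ℓJ : Level}
  (I : Interp S ℓ) (J : QSInterp S Φ ℓJ) (π : Interp.Δ I → QSInterp.Δ J)
  (quot : IsQSQuotient Φ I J π) where

  open Feats Φ
  open IsQSQuotient quot
  open Classical em
  open ListFacts
  open Equivalence using (to; from)
  private
    module A = Interp I
    module B = QSInterp J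

  Δ : Set ℓ
  Δ = A.Δ

  D : Set ℓJ
  D = B.Δ

  TC : Concept S Φ → Δ → Set ℓ
  TC C = ⟦_⟧ᵀ {Φ = Φ} I C

  TR : Role S Φ → Δ → Δ → Set ℓ
  TR R = ⟦_⟧ᵀR {Φ = Φ} I R

  QC : Concept S Φ → D → Set ℓJ
  QC C = ⟦_⟧ᵠ J C

  QR : Role S Φ → D → D → Set ℓJ
  QR R = ⟦_⟧ᵠR J R

  bR : Basic S Φ → Δ → Δ → Set ℓ
  bR = basicRel {Φ = Φ} I

  bR-irr : ∀ R x y → Irrelevant (bR R x y)
  bR-irr (bn r) x y = A.rol-prop r x y
  bR-irr (bi i r) x y = A.rol-prop r y x

  ∼⇒≡ : ∀ {x y} → x ∼ y → π x ≡ π y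
  ∼⇒≡ = from (π-ker _ _)

  ≡⇒∼ : ∀ {x y} → π x ≡ π y → x ∼ y
  ≡⇒∼ = to (π-ker _ _)

  rep : D → Δ
  rep z = proj₁ (π-surj z)

  π-rep : ∀ z → π (rep z) ≡ z
  π-rep z = proj₂ (π-surj z)

  ∼-forth : ∀ R {x x' y} → x ∼ x' → bR R x y → Σ Δ λ y' → y ∼ y' × bR R x' y'
  ∼-forth (bn r) (Z , isZ , xZx') t with IsBisim.B3 isZ r xZx' t
  ... | y' , yZy' , t' = y' , (Z , isZ , yZy') , t'
  ∼-forth (bi i r) (Z , isZ , xZx') t with IsBisim.B5 isZ i r xZx' t
  ... | y' , yZy' , t' = y' , (Z , isZ , yZy') , t'

  ∼-successors : T fQ → ∀ R {x x'} → x ∼ x' →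
    Σ (Σ Δ (bR R x) ⤖ Σ Δ (bR R x')) λ h → ∀ p → proj₁ p ∼ proj₁ (Bijection.to h p)
  ∼-successors qQ (bn r) (Z , isZ , xZx') with IsBisim.B8 isZ qQ xZx' r
  ... | h , hZ = h , λ p → Z , isZ , hZ p
  ∼-successors qQ (bi i r) (Z , isZ , xZx') with IsBisim.B9 isZ qQ i xZx' r
  ... | h , hZ = h , λ p → Z , isZ , hZ p

  -- with counting, the multiplicity QU(R)(πx, πy) is attained at x itself,
  -- not only at some element of its class
  multiplicity-attained : T fQ → ∀ R x y → Σ (List Δ) λ ys → Unique ys ×
    All (λ y' → y' ∼ y × bR R x y') ys × length ys ≡ B.QU R (π x) (π y)
  multiplicity-attained qQ R x y with q-QU-att R x y
  ... | x' , x'∼x , ys' , uys' , ys'-ok , len with ∼-successors qQ R x'∼x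
  ... | h , h∼ with transport {Q = _∼ y} (bR-irr R x) (Bijection.to h) (Bijection.injective h)
                      (λ p y'∼y → ≡⇒∼ (trans (sym (∼⇒≡ (h∼ p))) (∼⇒≡ y'∼y)))
                      ys' uys' ys'-ok
  ... | ys , uys , ys-ok , len' = ys , uys , ys-ok , trans len' len

  -- distinct R-successors of x whose classes lie in ws number at most the
  -- total multiplicity of ws; split them by whether their class is the head
  successors-bounded : ∀ R x ws ys → Unique ys → All (λ y → bR R x y × π y ∈ ws) ys →
    length ys ≤ sum (map (B.QU R (π x)) ws)
  successors-bounded R x [] [] _ _ = z≤n
  successors-bounded R x [] (y ∷ _) _ ((_ , ()) ∷ _)
  successors-bounded R x (w ∷ ws) ys uys ys-ok = begin
    length ys
      ≡⟨ length-partition-≡ in-w? ys ⟩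
    length (filter in-w? ys) + length (filter (∁? in-w?) ys)
      ≤⟨ +-mono-≤ in-w-bound others-bound ⟩
    B.QU R (π x) w + sum (map (B.QU R (π x)) ws) ∎
    where
    open ≤-Reasoning
    in-w? : Decidable (λ y → π y ≡ w)
    in-w? _ = em

    in-w-bound : length (filter in-w? ys) ≤ B.QU R (π x) w
    in-w-bound = subst (λ v → length (filter in-w? ys) ≤ B.QU R (π x) v) (π-rep w)
      (q-QU-ub R x (rep w) x (≡⇒∼ refl) _ (filter⁺ in-w? uys)
        (All.tabulate λ y∈ → let (y∈ys , πy≡w) = ∈-filter⁻ in-w? y∈ in
          ≡⇒∼ (trans πy≡w (sym (π-rep w))) , proj₁ (All.lookup ys-ok y∈ys)))

    not-head : ∀ {v} → v ≢ w → v ∈ w ∷ ws → v ∈ ws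
    not-head v≢w (here v≡w) = ⊥-elim (v≢w v≡w)
    not-head v≢w (there v∈ws) = v∈ws

    others-bound : length (filter (∁? in-w?) ys) ≤ sum (map (B.QU R (π x)) ws)
    others-bound = successors-bounded R x ws _ (filter⁺ (∁? in-w?) uys)
      (All.tabulate λ y∈ → let (y∈ys , πy≢w) = ∈-filter⁻ (∁? in-w?) y∈
                               (t , πy∈) = All.lookup ys-ok y∈ys in
        t , not-head πy≢w πy∈)

  module Counting {P : Δ → Set ℓ} {P' : D → Set ℓJ} (P⇔P' : ∀ y → P y ⇔ P' (π y)) where

    count-down : ∀ R x ys → Unique ys → All (λ y → bR R x y × P y) ys →
      Σ (List D) λ ws → Unique ws × All P' ws × length ys ≤ sum (map (B.QU R (π x)) ws)
    count-down R x ys uys ys-ok =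
      classes , deduplicate-! _≟_ (map π ys) ,
      All.tabulate (λ w∈ → let (y , y∈ys , w≡πy) = ∈-map⁻ π (∈-deduplicate⁻ _≟_ (map π ys) w∈) in
        subst P' (sym w≡πy) (to (P⇔P' y) (proj₂ (All.lookup ys-ok y∈ys)))) ,
      successors-bounded R x classes ys uys
        (All.tabulate λ y∈ys → proj₁ (All.lookup ys-ok y∈ys) , ∈-deduplicate⁺ _≟_ (∈-map⁺ π y∈ys))
      where
      classes : List D
      classes = deduplicate _≟_ (map π ys)

    count-up : T fQ → ∀ R x ws → Unique ws → All P' ws →
      Σ (List Δ) λ ys → Unique ys × All (λ y → bR R x y × P y) ys ×
        length ys ≡ sum (map (B.QU R (π x)) ws)
    count-up qQ R x ws uws P'ws =
      let (ys , uys , ys-ok , len , _) = realise ws uws P'ws in ys , uys , ys-ok , len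
      where
      -- the lists realising distinct classes are disjoint
      realise : ∀ ws → Unique ws → All P' ws →
        Σ (List Δ) λ ys → Unique ys × All (λ y → bR R x y × P y) ys ×
          length ys ≡ sum (map (B.QU R (π x)) ws) × All (λ y → π y ∈ ws) ys
      realise [] [] [] = [] , [] , [] , refl , []
      realise (w ∷ ws) (w∉ws ∷ uws) (P'w ∷ P'ws)
        with realise ws uws P'ws | multiplicity-attained qQ R x (rep w)
      ... | ys , uys , ys-ok , len , ys-cls | L , uL , L-ok , lenL =
        L ++ ys ,
        ++⁺ uL uys (λ (v∈L , v∈ys) →
          All.lookup w∉ws (subst (_∈ ws) (in-w v∈L) (All.lookup ys-cls v∈ys)) refl) ,
        All-++⁺ (All.tabulate λ {v} v∈L →
            proj₂ (All.lookup L-ok v∈L) , from (P⇔P' v) (subst P' (sym (in-w v∈L)) P'w)) ys-ok ,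
        trans (length-++ L) (cong₂ _+_ (trans lenL (cong (B.QU R (π x)) (π-rep w))) len) ,
        All-++⁺ (All.tabulate λ v∈L → here (in-w v∈L)) (All.map there ys-cls)
        where
        in-w : ∀ {v} → v ∈ L → π v ≡ w
        in-w v∈L = trans (∼⇒≡ (proj₁ (All.lookup L-ok v∈L))) (π-rep w)

    geq-transfer : T fQ → ∀ n R x → geqT {Φ = Φ} I n R P x ⇔ geqQ J n R P' (π x)
    geq-transfer qQ n R x = mk⇔
      (λ (ys , uys , ys-ok , n≤) → let (ws , uws , P'ws , ≤w) = count-down R x ys uys ys-ok in
        ws , uws , P'ws , ≤-trans n≤ ≤w)
      (λ (ws , uws , P'ws , n≤) → let (ys , uys , ys-ok , len) = count-up qQ R x ws uws P'ws in
        ys , uys , ys-ok , subst (n ≤_) (sym len) n≤)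

    leq-transfer : T fQ → ∀ n R x → leqT {Φ = Φ} I n R P x ⇔ leqQ J n R P' (π x)
    leq-transfer qQ n R x = mk⇔
      (λ ≤n ws uws P'ws → let (ys , uys , ys-ok , len) = count-up qQ R x ws uws P'ws in
        subst (_≤ n) len (≤n ys uys ys-ok))
      (λ ≤n ys uys ys-ok → let (ws , uws , P'ws , ≤w) = count-down R x ys uys ys-ok in
        ≤-trans ≤w (≤n ws uws P'ws))

  -- Simultaneously,
  -- π maps role edges of I to role edges of J, and every edge of J leaving
  -- (or, with inverses, entering) the class of x lifts to an edge of I at x.
  mutual
    truth : ∀ C x → TC C x ⇔ QC C (π x)
    truth (cn A₀) x = mk⇔ (λ Ax → from (q-con A₀ (π x)) (x , refl , Ax))
      (λ A[x] → let (x₀ , πx₀≡πx , Ax₀) = to (q-con A₀ (π x)) A[x] in B2 (≡⇒∼ πx₀≡πx) Ax₀)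
      where
      B2 : ∀ {x₀} → x₀ ∼ x → A.con A₀ x₀ → A.con A₀ x
      B2 (Z , isZ , x₀Zx) = to (IsBisim.B2 isZ x₀Zx A₀)
    truth top x = mk⇔ _ _
    truth bot x = mk⇔ (λ ()) (λ ())
    truth (neg C) x = mk⇔ (λ ¬C C' → ¬C (from (truth C x) C')) (λ ¬C C' → ¬C (to (truth C x) C'))
    truth (C ⊓c C') x = mk⇔ (λ (c , c') → to (truth C x) c , to (truth C' x) c')
                             (λ (c , c') → from (truth C x) c , from (truth C' x) c')
    truth (C ⊔c C') x = mk⇔ [ inj₁ ∘ to (truth C x) , inj₂ ∘ to (truth C' x) ]
                             [ inj₁ ∘ from (truth C x) , inj₂ ∘ from (truth C' x) ]
    truth (all R C) x = mk⇔
      (λ ∀C w t → let (y , πy≡w , t') = lift-forth R x t in subst (QC C) πy≡w (to (truth C y) (∀C y t')))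
      (λ ∀C y t → from (truth C y) (∀C (π y) (edge R t)))
    truth (ex R C) x = mk⇔
      (λ (y , t , c) → π y , edge R t , to (truth C y) c)
      (λ (w , t , c) → let (y , πy≡w , t') = lift-forth R x t in
        y , t' , from (truth C y) (subst (QC C) (sym πy≡w) c))
    truth (nom o a) x = mk⇔ (λ { refl → sym (q-ind a) }) (λ πx≡ → B7 (≡⇒∼ (trans πx≡ (q-ind a))))
      where
      B7 : x ∼ A.ind a → x ≡ A.ind a
      B7 (Z , isZ , xZa) = from (IsBisim.B7 isZ o xZa a) refl
    truth (geq qQ n r C) x = Counting.geq-transfer (λ y → truth C y) qQ n (bn r) x
    truth (leq qQ n r C) x = Counting.leq-transfer (λ y → truth C y) qQ n (bn r) x
    truth (geqInv qQ i n r C) x = Counting.geq-transfer (λ y → truth C y) qQ n (bi i r) x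
    truth (leqInv qQ i n r C) x = Counting.leq-transfer (λ y → truth C y) qQ n (bi i r) x
    truth (self s r) x = mk⇔ (λ t → from (q-SE r (π x)) (x , refl , t))
      (λ t → let (x₀ , πx₀≡πx , t₀) = to (q-SE r (π x)) t in B12 (≡⇒∼ πx₀≡πx) t₀)
      where
      B12 : ∀ {x₀} → x₀ ∼ x → A.rol r x₀ x₀ → A.rol r x x
      B12 (Z , isZ , x₀Zx) = to (IsBisim.B12 isZ s x₀Zx r)

    edge : ∀ R {x y} → TR R x y → QR R (π x) (π y)
    edge (rn r) {x} {y} t = from (q-rol r (π x) (π y)) (x , y , refl , refl , t)
    edge ε refl = refl
    edge (R ∘ᵣ R') (v , t , t') = π v , edge R t , edge R' t'
    edge (R ⊔ᵣ R') (inj₁ t) = inj₁ (edge R t)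
    edge (R ⊔ᵣ R') (inj₂ t) = inj₂ (edge R' t)
    edge (R *ᵣ) ts = edge* R ts
    edge (C ?ᵣ) {x} (refl , c) = refl , to (truth C x) c
    edge (inv i R) t = edge R t
    edge (univ u) t = _

    edge* : ∀ R {x y} → Star (TR R) x y → Star (QR R) (π x) (π y)
    edge* R ε = ε
    edge* R (t ◅ ts) = edge R t ◅ edge* R ts

    lift-forth : ∀ R x {w} → QR R (π x) w → Σ Δ λ y → π y ≡ w × TR R x y
    lift-forth (rn r) x {w} t with to (q-rol r (π x) w) t
    ... | x₀ , y₀ , πx₀≡πx , πy₀≡w , t₀ with ∼-forth (bn r) (≡⇒∼ πx₀≡πx) t₀
    ... | y , y₀∼y , t' = y , trans (sym (∼⇒≡ y₀∼y)) πy₀≡w , t'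
    lift-forth ε x refl = x , refl , refl
    lift-forth (R ∘ᵣ R') x {w} (v , t , t') with lift-forth R x t
    ... | y , πy≡v , s with lift-forth R' y (subst (λ u → QR R' u w) (sym πy≡v) t')
    ... | y' , πy'≡w , s' = y' , πy'≡w , (y , s , s')
    lift-forth (R ⊔ᵣ R') x (inj₁ t) = let (y , e , s) = lift-forth R x t in y , e , inj₁ s
    lift-forth (R ⊔ᵣ R') x (inj₂ t) = let (y , e , s) = lift-forth R' x t in y , e , inj₂ s
    lift-forth (R *ᵣ) x ts = lift-forth* R ts x refl
    lift-forth (C ?ᵣ) x (πx≡w , c) = x , πx≡w , (refl , from (truth C x) c)
    lift-forth (inv i R) x t = lift-back i R x t
    lift-forth (univ u) x {w} _ = rep w , π-rep w , _

    lift-forth* : ∀ R {z w} → Star (QR R) z w → ∀ x → π x ≡ z → Σ Δ λ y → π y ≡ w × Star (TR R) x y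
    lift-forth* R ε x πx≡z = x , πx≡z , ε
    lift-forth* R (t ◅ ts) x πx≡z with lift-forth R x (subst (λ u → QR R u _) (sym πx≡z) t)
    ... | y , πy≡v , s with lift-forth* R ts y πy≡v
    ... | y' , πy'≡w , ss = y' , πy'≡w , (s ◅ ss)

    lift-back : T fI → ∀ R y {w} → QR R w (π y) → Σ Δ λ x → π x ≡ w × TR R x y
    lift-back i (rn r) y {w} t with to (q-rol r w (π y)) t
    ... | x₀ , y₀ , πx₀≡w , πy₀≡πy , t₀ with ∼-forth (bi i r) (≡⇒∼ πy₀≡πy) t₀
    ... | x , x₀∼x , t' = x , trans (sym (∼⇒≡ x₀∼x)) πx₀≡w , t'
    lift-back i ε y refl = y , refl , refl
    lift-back i (R ∘ᵣ R') y {w} (v , t , t') with lift-back i R' y t'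
    ... | x' , πx'≡v , s' with lift-back i R x' (subst (QR R w) (sym πx'≡v) t)
    ... | x , πx≡w , s = x , πx≡w , (x' , s , s')
    lift-back i (R ⊔ᵣ R') y (inj₁ t) = let (x , e , s) = lift-back i R y t in x , e , inj₁ s
    lift-back i (R ⊔ᵣ R') y (inj₂ t) = let (x , e , s) = lift-back i R' y t in x , e , inj₂ s
    lift-back i (R *ᵣ) y ts = lift-back* i R ts y refl
    lift-back i (C ?ᵣ) y (w≡πy , c) = y , sym w≡πy , (refl , from (truth C y) (subst (QC C) w≡πy c))
    lift-back i (inv _ R) y t = lift-forth R y t
    lift-back i (univ u) y {w} _ = rep w , π-rep w , _

    lift-back* : T fI → ∀ R {z w} → Star (QR R) z w → ∀ y → π y ≡ w → Σ Δ λ x → π x ≡ z × Star (TR R) x y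
    lift-back* i R ε y πy≡w = y , πy≡w , ε
    lift-back* i R {z} (t ◅ ts) y πy≡w with lift-back* i R ts y πy≡w
    ... | x' , πx'≡v , ss with lift-back i R x' (subst (QR R z) (sym πx'≡v) t)
    ... | x , πx≡z , s = x , πx≡z , (s ◅ ss)

  sameTBox : SameTBox I J
  sameTBox C C' = mk⇔
    (λ C⊑C' z Cz → subst (QC C') (π-rep z)
      (to (truth C' (rep z)) (C⊑C' (rep z) (from (truth C (rep z)) (subst (QC C) (sym (π-rep z)) Cz)))))
    (λ C⊑C' x Cx → from (truth C' x) (C⊑C' (π x) (to (truth C x) Cx)))

  sameABox : SameABox I J
  sameABox C a = mk⇔ (λ Ca → subst (QC C) (sym (q-ind a)) (to (truth C (A.ind a)) Ca))
                     (λ Ca → from (truth C (A.ind a)) (subst (QC C) (q-ind a) Ca))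

  _≈_ : Δ → Δ → Set ℓ
  x ≈ y = ∀ C → TC C x ⇔ TC C y

  ≈-isEquivalence : IsEquivalence _≈_
  ≈-isEquivalence = record
    { refl = λ _ → ⇔.refl
    ; sym = λ x≈y C → ⇔.sym (x≈y C)
    ; trans = λ x≈y y≈z C → ⇔.trans (x≈y C) (y≈z C)
    }

  distinguish : ∀ {x y} → ¬ x ≈ y → Σ (Concept S Φ) λ C → TC C x × ¬ TC C y
  distinguish x≉y = byContradiction λ none → x≉y λ C → mk⇔
    (λ Cx → byContradiction λ ¬Cy → none (C , Cx , ¬Cy))
    (λ Cy → byContradiction λ ¬Cx → none (neg C , ¬Cx , λ ¬Cy → ¬Cy Cy))

  separator : ∀ y us → Σ (Concept S Φ) λ χ → TC χ y × (∀ {u} → u ∈ us → TC χ u → y ≈ u)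
  separator y [] = top , _ , λ ()
  separator y (u ∷ us) with separator y us | em {P = y ≈ u}
  ... | χ , χy , χ-sep | yes y≈u = χ , χy , λ { (here refl) _ → y≈u ; (there u∈) → χ-sep u∈ }
  ... | χ , χy , χ-sep | no y≉u with distinguish y≉u
  ... | C , Cy , ¬Cu = C ⊓c χ , (Cy , χy) ,
    λ { (here refl) (Cu , _) → ⊥-elim (¬Cu Cu) ; (there u∈) (_ , χu) → χ-sep u∈ χu }

  module HennessyMilner (fb : FinBranchingQS Φ J) where

    open Matching _≟_ _≈_ (λ _ _ → em) ≈-isEquivalence

    edge-basic : ∀ R {x y} → bR R x y → basicRel {Φ = Φ} B.base R (π x) (π y)
    edge-basic (bn r) t = edge (rn r) t
    edge-basic (bi i r) t = edge (rn r) t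

    Successors : Basic S Φ → Δ → Set ℓ
    Successors R x = Σ (List Δ) λ L → Unique L × All (bR R x) L × (∀ y → bR R x y → y ∈ L)

    -- there are finitely many: at most the multiplicities of the finitely many
    -- successor classes of πx
    successors : ∀ R x → Successors R x
    successors R x = enumerate-bounded (bR R x) (sum (map (B.QU R (π x)) classes))
      λ ys uys ys-ok → successors-bounded R x classes ys uys
        (All.tabulate λ y∈ → let t = All.lookup ys-ok y∈ in t , proj₂ (fb R (π x)) _ (edge-basic R t))
      where
      classes : List D
      classes = proj₁ (fb R (π x))

    -- separate y from the R-successors of x' to find its ∃R-witness there
    ≈-forth : ∀ R {x x' y} → x ≈ x' → bR R x y → Σ Δ λ y' → y ≈ y' × bR R x' y'
    ≈-forth R {x} {x'} {y} x≈x' t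
      with successors R x' | separator y (proj₁ (successors R x'))
    ... | L , _ , _ , L-all | χ , χy , χ-sep
      with to (x≈x' (ex (roleOf R) χ)) (y , roleOf⁺ I R t , χy)
    ... | y' , t' , χy' = y' , χ-sep (L-all y' (roleOf⁻ I R t')) χy' , roleOf⁻ I R t'

    -- with counting, each ≈-class of R-successors of x has at most as many
    -- members as among those of x': transfer ≥ n R.χ for χ separating the class
    ≈-dominated : T fQ → ∀ R {x x'} → x ≈ x' →
      Dominated (proj₁ (successors R x)) (proj₁ (successors R x'))
    ≈-dominated qQ R {x} {x'} x≈x' y F uF F⊆La y≈F
      with successors R x | successors R x'
    ... | La , _ , La-ok , _ | Lb , _ , _ , Lb-all with separator y Lb
    ... | χ , χy , χ-sep with to (x≈x' (atLeast qQ (length F) R χ))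
                                (atLeast⁺ I qQ (length F) R χ
                                  (F , uF , All.tabulate (λ f∈ →
                                    All.lookup La-ok (F⊆La f∈) , to (All.lookup y≈F f∈ χ) χy) , ≤-refl))
    ... | ≥F with atLeast⁻ I qQ (length F) R χ ≥F
    ... | G , uG , G-ok , F≤G =
      G , uG , (λ {g} g∈ → Lb-all g (proj₁ (All.lookup G-ok g∈))) ,
      All.tabulate (λ {g} g∈ → let (t , χg) = All.lookup G-ok g∈ in χ-sep (Lb-all g t) χg) , F≤G

    ≈-successors : T fQ → ∀ R {x x'} → x ≈ x' →
      Σ (Σ Δ (bR R x) ⤖ Σ Δ (bR R x')) λ h → ∀ p → proj₁ p ≈ proj₁ (Bijection.to h p)
    ≈-successors qQ R {x} {x'} x≈x'
      with successors R x | successors R x'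
         | ≈-dominated qQ R x≈x' | ≈-dominated qQ R (IsEquivalence.sym ≈-isEquivalence x≈x')
    ... | La , uLa , La-ok , La-all | Lb , _ , Lb-ok , Lb-all | dom | dom⁻ =
      matching⇒bijection (bR-irr R x) (bR-irr R x') uLa
        (mk⇔ (All.lookup La-ok) (La-all _)) (mk⇔ (All.lookup Lb-ok) (Lb-all _))
        (match La Lb uLa dom dom⁻)

    ≈-isBisim : IsBisim Φ I I _≈_
    ≈-isBisim = record
      { B1 = λ a → ≈-refl
      ; B2 = λ x≈x' A₀ → x≈x' (cn A₀)
      ; B3 = λ r → ≈-forth (bn r)
      ; B4 = λ r x≈x' t → let (y , y'≈y , t') = ≈-forth (bn r) (≈-sym x≈x') t in y , ≈-sym y'≈y , t'
      ; B5 = λ i r → ≈-forth (bi i r)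
      ; B6 = λ i r x≈x' t → let (y , y'≈y , t') = ≈-forth (bi i r) (≈-sym x≈x') t in y , ≈-sym y'≈y , t'
      ; B7 = λ o x≈x' a → x≈x' (nom o a)
      ; B8 = λ qQ x≈x' r → ≈-successors qQ (bn r) x≈x'
      ; B9 = λ qQ i x≈x' r → ≈-successors qQ (bi i r) x≈x'
      ; B10 = λ _ x → x , ≈-refl
      ; B11 = λ _ x → x , ≈-refl
      ; B12 = λ s x≈x' r → x≈x' (self s r)
      }
      where open IsEquivalence ≈-isEquivalence renaming (refl to ≈-refl; sym to ≈-sym)

    ≈⇒≡ : ∀ {x y} → x ≈ y → π x ≡ π y
    ≈⇒≡ x≈y = ∼⇒≡ (_≈_ , ≈-isBisim , x≈y)

    module Characteristic (zs : List D) where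

      χ : D → Concept S Φ
      χ z = proj₁ (separator (rep z) (map rep zs))

      χ-only : ∀ {z w} → w ∈ zs → TC (χ z) (rep w) → z ≡ w
      χ-only {z} {w} w∈ χz =
        trans (sym (π-rep z))
          (trans (≈⇒≡ (proj₂ (proj₂ (separator (rep z) (map rep zs))) (∈-map⁺ rep w∈) χz)) (π-rep w))

      ψ : D → Concept S Φ
      ψ z = χ z ⊓c ⨅ (map (neg ∘ χ) (remove _≟_ z zs))

      ψ-rep : ∀ {z} → z ∈ zs → TC (ψ z) (rep z)
      ψ-rep {z} z∈ = proj₁ (proj₂ (separator (rep z) (map rep zs))) ,
        ⨅-intro I _ (All-map⁺ (All.tabulate λ w∈ χw →
          proj₂ (∈-remove⁻ _≟_ zs w∈) (χ-only z∈ χw)))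

      ψ-disjoint : ∀ {ℓK} (K : QSInterp S Φ ℓK) {z w k} → w ∈ zs →
        ⟦_⟧ᵠ K (ψ z) k → ⟦_⟧ᵠ K (ψ w) k → z ≡ w
      ψ-disjoint K w∈ (_ , not-others) (χw , _) = byContradiction λ z≢w →
        All.lookup (All-map⁻ (⨅-elim K _ not-others)) (∈-remove⁺ _≟_ w∈ (z≢w ∘ sym)) χw

    -- a QS-interpretation realising I receives every list of classes injectively,
    -- via witnesses of the characteristic concepts
    realises⇒list-embeddings : ∀ {ℓK} {K : QSInterp S Φ ℓK} → Realises I K →
      ∀ zs → ListEmbedding D zs (QSInterp.Δ K)
    realises⇒list-embeddings {K = K} realise zs =
      (λ z∈ → proj₁ (witness z∈)) ,
      λ z∈ w∈ same → ψ-disjoint K w∈ (proj₂ (witness z∈)) (subst (⟦_⟧ᵠ K (ψ _)) (sym same) (proj₂ (witness w∈)))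
      where
      open Characteristic zs
      witness : ∀ {z} → z ∈ zs → Σ (QSInterp.Δ K) (⟦_⟧ᵠ K (ψ z))
      witness {z} z∈ = realise (ψ z) (rep z) (ψ-rep z∈)

    -- without unreachable objects, J is exhausted by the classes reachable
    -- from named ones in at most n steps
    exhaustion : NoUnreachable Φ I → Exhaustion D
    exhaustion reach = record { stage = stage ; grows = λ n → _ , refl ; covers = covers }
      where
      successorClasses : D → List D
      successorClasses z = concatMap (λ R → proj₁ (fb R z)) basicRoles

      next : List D → List D
      next = concatMap successorClasses

      stage : ℕ → List D
      stage zero = map B.ind (allFin _)
      stage (suc n) = stage n ++ next (stage n)

      step : ∀ {u v} → BasicStep I u v → ∀ n → π u ∈ stage n → π v ∈ stage (suc n)
      step {u} (R , t) n πu∈ = ∈-++⁺ʳ (stage n) (∈-concatMap⁺ successorClasses (Any.map (λ { refl →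
        ∈-concatMap⁺ (λ R → proj₁ (fb R (π u))) (Any.map (λ { refl → proj₂ (fb R (π u)) _ (edge-basic R t) })
          (∈-basicRoles R)) }) πu∈))

      walk : ∀ {u v} → Star (BasicStep I) u v → ∀ n → π u ∈ stage n → Σ ℕ λ m → π v ∈ stage m
      walk ε n πu∈ = n , πu∈
      walk (s ◅ path) n πu∈ = walk path (suc n) (step s n πu∈)

      covers : ∀ z → Σ ℕ λ n → z ∈ stage n
      covers z with reach (rep z)
      ... | a , path with walk path zero (subst (_∈ stage zero) (q-ind a) (∈-map⁺ B.ind (∈-allFin a)))
      ... | n , z∈ = n , subst (_∈ stage n) (π-rep z) z∈

  minimal-TBox : ∀ ℓK → FiniteQS Φ J → MinimalAmong ℓ ℓK (λ K → SameTBox I K) J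
  minimal-TBox ℓK (zs , all∈) = sameTBox , λ K same →
    embedding-from-lists (realises⇒list-embeddings {K = K} (sameTBox⇒realises em {I = I} {K} same))
      λ infinite → ⊥-elim (infinite (zs , all∈))
    where open HennessyMilner (λ _ _ → zs , λ w _ → all∈ w)  -- a finite J is finitely branching

  minimal-ABox : ∀ ℓK → NoUnreachable Φ I → FinBranchingQS Φ J →
    MinimalAmong ℓ ℓK (λ K → SameABox I K) J
  minimal-ABox ℓK reach fb = sameABox , λ K same →
    embedding-from-lists (realises⇒list-embeddings {K = K} (sameABox⇒realises {K = K} reach same))
      λ _ → exhaustion⇒ℕ-embedding (exhaustion reach)
    where open HennessyMilner fb

theorem13 : (∀ {ℓ} → ExcludedMiddle ℓ) →
    {S : Sig} (Φ : Feats) {ℓ ℓJ : Level} (I : Interp S ℓ) →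
    NoUnreachable Φ I →
    (J : QSInterp S Φ ℓJ) (π : Interp.Δ I → QSInterp.Δ J) →
    IsQSQuotient Φ I J π →
    (ℓK : Level) →
    (FiniteQS Φ J → MinimalAmong ℓ ℓK (λ K → SameTBox I K) J)
    × (FinBranchingQS Φ J → MinimalAmong ℓ ℓK (λ K → SameABox I K) J)
theorem13 em Φ I reach J π quot ℓK = minimal-TBox ℓK , minimal-ABox ℓK reach
  where open Quotient em Φ I J π quot
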